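{- Let $G=(V,A)$ be a directed graph, $k$ a positive integer, $u\neq v$ vertices of $G$, $T$ a $u$-directed tree in $G$ with $k$ arcs and $T'$ a $v$-directed tree in $G$ with $k$ arcs. If $G$ has a directed path from $u$ to $v$ or from $v$ to $u$, then there is a sequence $\langle T=T_0,\ldots,T_\ell=T'\rangle$ of directed trees in $G$, each with $k$ arcs, such that $|A(T_i)\setminus A(T_{i+1})|=|A(T_{i+1})\setminus A(T_i)|=1$ for all $0\le i<\ell$.
   Context: A directed tree is a directed graph whose underlying undirected graph is a tree and in which every vertex except one vertex $r$ has in-degree exactly $1$; $r$ is its root and the tree is called an $r$-directed tree. The directed trees in the sequence may have arbitrary roots. -}

module Defs where

open import Data.Nat using (ℕ; zero; suc; _+_; _≤_)
open import Data.Fin using (Fin)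
open import Data.Bool using (Bool; true; false; _∧_; not; if_then_else_)
open import Data.List using (List; []; _∷_; map; length)
open import Data.Nat.ListAction using (sum)
open import Data.List.Base using (allFin)
open import Data.Product using (_×_; _,_; ∃; Σ)
open import Data.Sum using (_⊎_)
open import Data.List.Relation.Unary.Unique.Propositional using (Unique)
open import Relation.Binary.PropositionalEquality using (_≡_)
open import Relation.Nullary using (¬_)

-- A (finite) directed graph on vertex set Fin n is given by its arc set,
-- a Boolean adjacency relation: arc (x , y) ∈ A  iff  A x y ≡ true.
ArcSet : ℕ → Set
ArcSet n = Fin n → Fin n → Bool

Digraph : ℕ → Set
Digraph = ArcSet

module _ {n : ℕ} where

  b2n : Bool → ℕ
  b2n b = if b then 1 else 0

  ∣_∣ₐ : ArcSet n → ℕ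
  ∣ S ∣ₐ = sum (map (λ x → sum (map (λ y → b2n (S x y)) (allFin n))) (allFin n))

  _∖_ : ArcSet n → ArcSet n → ArcSet n
  (S ∖ T) x y = S x y ∧ not (T x y)

  _⊆ₐ_ : ArcSet n → ArcSet n → Set
  S ⊆ₐ T = ∀ x y → S x y ≡ true → T x y ≡ true

  indeg : ArcSet n → Fin n → ℕ
  indeg T x = sum (map (λ y → b2n (T y x)) (allFin n))

  InV : ArcSet n → Fin n → Set
  InV T x = ∃ λ y → (T x y ≡ true) ⊎ (T y x ≡ true)

  -- walks in the underlying undirected multigraph of T: each step
  -- traverses an arc forwards or backwards
  data UWalk (T : ArcSet n) : Fin n → Fin n → Set where
    []  : ∀ {x} → UWalk T x x
    fwd : ∀ {x y z} → T x y ≡ true → UWalk T y z → UWalk T x z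
    bwd : ∀ {x y z} → T y x ≡ true → UWalk T y z → UWalk T x z

  uarcs : ∀ {T x y} → UWalk T x y → List (Fin n × Fin n)
  uarcs [] = []
  uarcs (fwd {x} {y} _ w) = (x , y) ∷ uarcs w
  uarcs (bwd {x} {y} _ w) = (y , x) ∷ uarcs w

  -- vertices of a walk at which steps start (omits the final vertex)
  ustarts : ∀ {T x y} → UWalk T x y → List (Fin n)
  ustarts [] = []
  ustarts (fwd {x} _ w) = x ∷ ustarts w
  ustarts (bwd {x} _ w) = x ∷ ustarts w

  -- a cycle of the underlying undirected multigraph: a closed walk with
  -- at least one edge, no repeated edge and no repeated vertex
  -- (apart from first = last)
  UCycle : ArcSet n → Set
  UCycle T = Σ (Fin n) λ x → Σ (UWalk T x x) λ w →
               (1 ≤ length (uarcs w)) × Unique (uarcs w) × Unique (ustarts w)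

  IsUTree : ArcSet n → Set
  IsUTree T = (∀ x y → InV T x → InV T y → UWalk T x y) × ¬ UCycle T

  IsDirTree : ArcSet n → Fin n → Set
  IsDirTree T r = IsUTree T × InV T r × (∀ x → InV T x → ¬ (x ≡ r) → indeg T x ≡ 1)

  DirTreeIn : Digraph n → ℕ → ArcSet n → Set
  DirTreeIn G k T = T ⊆ₐ G × ∣ T ∣ₐ ≡ k × ∃ λ r → IsDirTree T r

  data DWalk (G : Digraph n) : Fin n → Fin n → Set where
    []  : ∀ {x} → DWalk G x x
    _∷_ : ∀ {x y z} → G x y ≡ true → DWalk G y z → DWalk G x z

  dverts : ∀ {G x y} → DWalk G x y → List (Fin n)
  dverts {y = y} [] = y ∷ []
  dverts (_∷_ {x} _ w) = x ∷ dverts w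

  DPath : Digraph n → Fin n → Fin n → Set
  DPath G x y = Σ (DWalk G x y) λ w → Unique (dverts w)

{-# OPTIONS --safe #-}
module Submission where

-- Directed trees are handled through rank functions that increase strictly along arcs
-- (RankedTree), which are equivalent to IsDirTree. Exchanging one arc of such a tree for another
-- keeps it a directed tree with k arcs in four situations: moving a leaf; deleting a leaf arc and
-- attaching a new root x by an arc x → r; cutting a vertex x off its parent and adding the arc
-- x → r, so that x becomes the root; and rehanging a subtree below a vertex outside it.
-- For an arc x → y of G, one of the two middle exchanges turns a y-rooted tree into an adjacent
-- x-rooted one, so following the path between u and v reaches a tree with the same root as the
-- other given tree. Two trees with a common root r are connected by letting their common subtree
-- at r grow by one vertex per step: a frontier arc (a , b) of the target is added by rehanging b
-- below a or, when b is not yet a vertex, by moving there a leaf outside the common subtree.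
-- A path from v to u is handled by reversing the resulting chain.

open import Defs
open import Data.Bool using (Bool; true; false; _∧_; not; if_then_else_)
import Data.Bool.Properties as Bool
open import Data.Empty using (⊥; ⊥-elim)
open import Data.Fin using (Fin; zero; suc; _≟_; inject₁; fromℕ)
open import Data.Fin.Properties using (any?; suc-injective)
open import Data.List using (List; []; _∷_; map; length; tabulate; allFin; filter)
open import Data.List.Extrema.Nat using (argmax; argmax-all; v≤f[argmax]⁺)
open import Data.List.Membership.Propositional using (_∈_)
import Data.List.Membership.DecPropositional as DecMembership
open import Data.List.Membership.Propositional.Properties using (∈-filter⁺; ∈-allFin)
open import Data.List.Relation.Unary.All using (All; []; _∷_)
import Data.List.Relation.Unary.All as All
open import Data.List.Relation.Unary.All.Properties using (all-filter)
open import Data.List.Relation.Unary.All.Properties.Core using (¬Any⇒All¬)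
open import Data.List.Relation.Unary.AllPairs using ([]; _∷_)
open import Data.List.Relation.Unary.Any using (here; there)
import Data.List.Relation.Unary.Any as Any
open import Data.List.Relation.Unary.Unique.Propositional using (Unique)
open import Data.Nat using (ℕ; zero; suc; _+_; _≤_; _<_; z≤n; s≤s)
open import Data.Nat.ListAction using (sum)
open import Data.Nat.Properties hiding (_≟_; suc-injective)
open import Data.Product using (_×_; _,_; ∃; Σ; proj₁; proj₂)
open import Data.Sum using (_⊎_; inj₁; inj₂)
open import Function using (_∘_)
open import Function.Bundles using (mk⇔)
open import Relation.Binary.PropositionalEquality
open import Relation.Nullary using (¬_; Dec; yes; no; does; _×-dec_; _⊎-dec_; ¬?)
open import Relation.Nullary.Decidable using (dec-true; dec-false; does-⇔; decidable-stable)
open import Relation.Unary using (Decidable)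

-- Finite sums, counting and maxima

_∉ᴬ_ : {A : Set} → A → List A → Set
x ∉ᴬ xs = All (λ y → ¬ x ≡ y) xs

argmax-of : ∀ {m} (f : Fin m → ℕ) {P : Fin m → Set} → Decidable P → ∀ {z₀} → P z₀ →
            ∃ λ z → P z × (∀ w → P w → f w ≤ f z)
argmax-of {m} f P? {z₀} Pz₀ =
  argmax f z₀ candidates , argmax-all f Pz₀ (all-filter P? (allFin m)) ,
  λ w Pw → v≤f[argmax]⁺ z₀ candidates
              (inj₂ (Any.map (λ { refl → ≤-refl }) (∈-filter⁺ P? (∈-allFin w) Pw)))
  where candidates = filter P? (allFin m)

sumFin : ∀ {m} → (Fin m → ℕ) → ℕ
sumFin {zero}  f = 0
sumFin {suc m} f = f zero + sumFin (f ∘ suc)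

sum-map-tabulate : ∀ {m} {A : Set} (g : Fin m → A) (f : A → ℕ) →
                   sum (map f (tabulate g)) ≡ sumFin (f ∘ g)
sum-map-tabulate {zero}  g f = refl
sum-map-tabulate {suc m} g f = cong (f (g zero) +_) (sum-map-tabulate (g ∘ suc) f)

sumFin-cong : ∀ {m} {f g : Fin m → ℕ} → (∀ i → f i ≡ g i) → sumFin f ≡ sumFin g
sumFin-cong {zero}  e = refl
sumFin-cong {suc m} e = cong₂ _+_ (e zero) (sumFin-cong (e ∘ suc))

sumFin-mono : ∀ {m} {f g : Fin m → ℕ} → (∀ i → f i ≤ g i) → sumFin f ≤ sumFin g
sumFin-mono {zero}  e = z≤n
sumFin-mono {suc m} e = +-mono-≤ (e zero) (sumFin-mono (e ∘ suc))

sumFin-mono-< : ∀ {m} {f g : Fin m → ℕ} → (∀ i → f i ≤ g i) →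
                ∀ p → f p < g p → sumFin f < sumFin g
sumFin-mono-< {suc m} e zero    lt = +-mono-<-≤ lt (sumFin-mono (e ∘ suc))
sumFin-mono-< {suc m} e (suc p) lt = +-mono-≤-< (e zero) (sumFin-mono-< (e ∘ suc) p lt)

sumFin-≤ : ∀ {m} {f : Fin m → ℕ} → (∀ i → f i ≤ 1) → sumFin f ≤ m
sumFin-≤ {zero}  e = z≤n
sumFin-≤ {suc m} e = +-mono-≤ (e zero) (sumFin-≤ (e ∘ suc))

term≤sumFin : ∀ {m} (f : Fin m → ℕ) i → f i ≤ sumFin f
term≤sumFin {suc m} f zero    = m≤m+n (f zero) _
term≤sumFin {suc m} f (suc i) = ≤-trans (term≤sumFin (f ∘ suc) i) (m≤n+m _ (f zero))

sumFin-pos : ∀ {m} (f : Fin m → ℕ) → 1 ≤ sumFin f → ∃ λ i → 1 ≤ f i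
sumFin-pos {suc m} f h with f zero in eq
... | suc _ = zero , subst (1 ≤_) (sym eq) (s≤s z≤n)
... | zero  with i , q ← sumFin-pos (f ∘ suc) h = suc i , q

sumFin-two : ∀ {m} (f : Fin m → ℕ) p q → ¬ p ≡ q → 1 ≤ f p → 1 ≤ f q → 2 ≤ sumFin f
sumFin-two {suc m} f zero    zero    p≢q _  _  = ⊥-elim (p≢q refl)
sumFin-two {suc m} f zero    (suc q) _   fp fq = +-mono-≤ fp (≤-trans fq (term≤sumFin (f ∘ suc) q))
sumFin-two {suc m} f (suc p) zero    p≢q fp fq = sumFin-two f zero (suc p) (p≢q ∘ sym) fq fp
sumFin-two {suc m} f (suc p) (suc q) p≢q fp fq =
  ≤-trans (sumFin-two (f ∘ suc) p q (p≢q ∘ cong suc) fp fq) (m≤n+m _ (f zero))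

sumFin-suc : ∀ {m} {f g : Fin m → ℕ} p → (∀ i → ¬ i ≡ p → f i ≡ g i) →
             g p ≡ suc (f p) → sumFin g ≡ suc (sumFin f)
sumFin-suc {suc m} zero e gp =
  cong₂ _+_ gp (sumFin-cong (λ i → sym (e (suc i) λ ())))
sumFin-suc {suc m} {f} (suc p) e gp =
  trans (cong₂ _+_ (sym (e zero λ ())) (sumFin-suc p (λ i i≢p → e (suc i) (i≢p ∘ suc-injective)) gp))
        (+-suc (f zero) _)

sumFin-zero : ∀ {m} {f : Fin m → ℕ} → (∀ i → f i ≡ 0) → sumFin f ≡ 0
sumFin-zero {zero}  e = refl
sumFin-zero {suc m} e = cong₂ _+_ (e zero) (sumFin-zero (e ∘ suc))

dec-true⁻¹ : ∀ {A : Set} (a? : Dec A) → does a? ≡ true → A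
dec-true⁻¹ (yes a) _ = a

module _ {m : ℕ} where

  count : (Fin m → Bool) → ℕ
  count h = sumFin (λ y → b2n {m} (h y))

  private
    b2n-mono : ∀ {a b} → (a ≡ true → b ≡ true) → b2n {m} a ≤ b2n {m} b
    b2n-mono {false} _ = z≤n
    b2n-mono {true}  a⇒b rewrite a⇒b refl = ≤-refl

    b2n≤1 : ∀ b → b2n {m} b ≤ 1
    b2n≤1 true  = ≤-refl
    b2n≤1 false = z≤n

    b2n-true : ∀ {b} → b ≡ true → 1 ≤ b2n {m} b
    b2n-true refl = ≤-refl

    b2n-pos : ∀ {b} → 1 ≤ b2n {m} b → b ≡ true
    b2n-pos {true} _ = refl

  count-mono : ∀ {h h′} → (∀ y → h y ≡ true → h′ y ≡ true) → count h ≤ count h′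
  count-mono h⇒h′ = sumFin-mono (λ y → b2n-mono (h⇒h′ y))

  count-mono-< : ∀ {h h′} → (∀ y → h y ≡ true → h′ y ≡ true) →
                 ∀ p → h p ≡ false → h′ p ≡ true → count h < count h′
  count-mono-< h⇒h′ p hp h′p =
    sumFin-mono-< (λ y → b2n-mono (h⇒h′ y)) p
                  (subst₂ (λ a b → b2n {m} a < b2n {m} b) (sym hp) (sym h′p) ≤-refl)

  count≤ : ∀ h → count h ≤ m
  count≤ h = sumFin-≤ (λ y → b2n≤1 (h y))

  count-pos : ∀ h → 1 ≤ count h → ∃ λ y → h y ≡ true
  count-pos h pos with y , hy ← sumFin-pos _ pos = y , b2n-pos hy

  count-two : ∀ h p q → ¬ p ≡ q → h p ≡ true → h q ≡ true → 2 ≤ count h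
  count-two h p q p≢q hp hq =
    sumFin-two _ p q p≢q (b2n-true hp) (b2n-true hq)

  count-insert : ∀ {h h′} p → (∀ y → ¬ y ≡ p → h y ≡ h′ y) → h p ≡ false → h′ p ≡ true →
                 count h′ ≡ suc (count h)
  count-insert p same hp h′p =
    sumFin-suc p (λ y y≢p → cong (b2n {m}) (same y y≢p))
                 (subst₂ (λ a b → b2n {m} b ≡ suc (b2n {m} a)) (sym hp) (sym h′p) refl)

  count-none : ∀ {h} → (∀ y → h y ≡ false) → count h ≡ 0
  count-none none = sumFin-zero (λ y → cong (b2n {m}) (none y))

  count-one : ∀ h p → h p ≡ true → (∀ y → h y ≡ true → y ≡ p) → count h ≡ 1
  count-one h p hp only =
    trans (count-insert {h = λ _ → false} p (λ y y≢p → sym (Bool.¬-not (y≢p ∘ only y))) refl hp)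
          (cong suc (count-none λ _ → refl))

  open DecMembership (_≟_ {m}) using (_∈?_)

  private
    count-∈-Unique : ∀ xs → Unique xs → count (λ x → does (x ∈? xs)) ≡ length xs
    count-∈-Unique [] _ = count-none (λ x → dec-false (x ∈? []) λ ())
    count-∈-Unique (p ∷ xs) (p∉xs ∷ u) =
      trans (count-insert p (λ x x≢p → does-⇔ (mk⇔ there (drop-head x≢p)) (x ∈? xs) (x ∈? (p ∷ xs)))
                            (dec-false (p ∈? xs) (λ p∈xs → All.lookup p∉xs p∈xs refl))
                            (dec-true (p ∈? (p ∷ xs)) (here refl)))
            (cong suc (count-∈-Unique xs u))
      where
        drop-head : ∀ {x} → ¬ x ≡ p → x ∈ p ∷ xs → x ∈ xs
        drop-head x≢p (here x≡p) = ⊥-elim (x≢p x≡p)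
        drop-head x≢p (there x∈xs) = x∈xs

  Unique⇒length≤ : ∀ xs → Unique xs → length xs ≤ m
  Unique⇒length≤ xs u = subst (_≤ m) (count-∈-Unique xs u) (count≤ _)

-- Arc sets

module _ {n : ℕ} where

  _≐_ : ArcSet n → ArcSet n → Set
  S ≐ S′ = ∀ x y → S x y ≡ S′ x y

  ≐-sym : ∀ {S S′} → S ≐ S′ → S′ ≐ S
  ≐-sym e x y = sym (e x y)

  ≐-trans : ∀ {S S′ S′′} → S ≐ S′ → S′ ≐ S′′ → S ≐ S′′
  ≐-trans e e′ x y = trans (e x y) (e′ x y)

  private
    size : ArcSet n → ℕ
    size S = sumFin (λ x → count (S x))

    ∣∣ₐ≡size : ∀ S → ∣ S ∣ₐ ≡ size S
    ∣∣ₐ≡size S =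
      trans (sum-map-tabulate {n} (λ x → x) (λ x → sum (map (λ y → b2n {n} (S x y)) (allFin n))))
            (sumFin-cong λ x → sum-map-tabulate {n} (λ y → y) (λ y → b2n {n} (S x y)))

    ∅ : ArcSet n
    ∅ _ _ = false

    ∣∅∣ₐ : ∣ ∅ ∣ₐ ≡ 0
    ∣∅∣ₐ = trans (∣∣ₐ≡size ∅) (sumFin-zero λ x → count-none {h = ∅ x} λ _ → refl)

  indeg≡count : ∀ T x → indeg T x ≡ count (λ y → T y x)
  indeg≡count T x = sum-map-tabulate {n} (λ y → y) (λ y → b2n {n} (T y x))

  ∣∣ₐ-cong : ∀ {S S′} → S ≐ S′ → ∣ S ∣ₐ ≡ ∣ S′ ∣ₐ
  ∣∣ₐ-cong {S} {S′} e = begin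
    ∣ S ∣ₐ    ≡⟨ ∣∣ₐ≡size S ⟩
    size S   ≡⟨ sumFin-cong (λ x → sumFin-cong λ y → cong (b2n {n}) (e x y)) ⟩
    size S′  ≡⟨ ∣∣ₐ≡size S′ ⟨
    ∣ S′ ∣ₐ   ∎
    where open ≡-Reasoning

  ∣∣ₐ-mono-< : ∀ {S S′} → S ⊆ₐ S′ → ∀ a b → S a b ≡ false → S′ a b ≡ true →
               ∣ S ∣ₐ < ∣ S′ ∣ₐ
  ∣∣ₐ-mono-< {S} {S′} S⊆S′ a b Sab S′ab =
    subst₂ _<_ (sym (∣∣ₐ≡size S)) (sym (∣∣ₐ≡size S′))
           (sumFin-mono-< (λ x → count-mono (S⊆S′ x)) a (count-mono-< (S⊆S′ a) b Sab S′ab))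

  ⊆ₐ∧∣∣ₐ≡⇒≐ : ∀ {S S′} → S ⊆ₐ S′ → ∣ S ∣ₐ ≡ ∣ S′ ∣ₐ → S ≐ S′
  ⊆ₐ∧∣∣ₐ≡⇒≐ {S} {S′} S⊆S′ ∣S∣≡∣S′∣ x y with S x y in Sxy | S′ x y in S′xy
  ... | true  | true  = refl
  ... | false | false = refl
  ... | true  | false with () ← trans (sym (S⊆S′ x y Sxy)) S′xy
  ... | false | true  = ⊥-elim (<-irrefl ∣S∣≡∣S′∣ (∣∣ₐ-mono-< S⊆S′ x y Sxy S′xy))

  ∣∣ₐ-pos : ∀ S → 1 ≤ ∣ S ∣ₐ → ∃ λ x → ∃ λ y → S x y ≡ true
  ∣∣ₐ-pos S pos with x , Sx-pos ← sumFin-pos _ (subst (1 ≤_) (∣∣ₐ≡size S) pos) =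
    x , count-pos (S x) Sx-pos

  ∣∣ₐ-insert : ∀ {S S′} a b → (∀ x y → ¬ (x ≡ a × y ≡ b) → S x y ≡ S′ x y) →
               S a b ≡ false → S′ a b ≡ true → ∣ S′ ∣ₐ ≡ suc ∣ S ∣ₐ
  ∣∣ₐ-insert {S} {S′} a b same Sab S′ab =
    subst₂ (λ s s′ → s′ ≡ suc s) (sym (∣∣ₐ≡size S)) (sym (∣∣ₐ≡size S′))
      (sumFin-suc a (λ x x≢a → sumFin-cong λ y → cong (b2n {n}) (same x y (x≢a ∘ proj₁)))
                    (count-insert {h = S a} {h′ = S′ a} b (λ y y≢b → same a y (y≢b ∘ proj₂)) Sab S′ab))

  same? : (x y a b : Fin n) → Dec (x ≡ a × y ≡ b)
  same? x y a b with x ≟ a | y ≟ b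
  ... | yes refl | yes refl = yes (refl , refl)
  ... | yes _    | no y≢b   = no (y≢b ∘ proj₂)
  ... | no x≢a   | _        = no (x≢a ∘ proj₁)

  arc : Fin n → Fin n → ArcSet n
  arc a b x y = does (same? x y a b)

  ∣arc∣ₐ : ∀ a b → ∣ arc a b ∣ₐ ≡ 1
  ∣arc∣ₐ a b = trans (∣∣ₐ-insert {S = ∅} a b (λ x y ≢ab → sym (dec-false (same? x y a b) ≢ab)) refl
                                     (dec-true (same? a b a b) (refl , refl)))
                     (cong suc ∣∅∣ₐ)

  record Adjacent (T T′ : ArcSet n) : Set where
    constructor adjacent
    field
      removed : ∣ T ∖ T′ ∣ₐ ≡ 1
      added   : ∣ T′ ∖ T ∣ₐ ≡ 1

  Adjacent-sym : ∀ {T T′} → Adjacent T T′ → Adjacent T′ T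
  Adjacent-sym (adjacent removed added) = adjacent added removed

  Adjacent-respʳ-≐ : ∀ {T T₁ T₂} → Adjacent T T₁ → T₁ ≐ T₂ → Adjacent T T₂
  Adjacent-respʳ-≐ {T} (adjacent removed added) e =
    adjacent (trans (∣∣ₐ-cong λ x y → cong (λ b → T x y ∧ not b) (sym (e x y))) removed)
             (trans (∣∣ₐ-cong λ x y → cong (λ b → b ∧ not (T x y)) (sym (e x y))) added)

  Adjacent-respˡ-≐ : ∀ {T₀ T T₁} → T₀ ≐ T → Adjacent T T₁ → Adjacent T₀ T₁
  Adjacent-respˡ-≐ e adj = Adjacent-sym (Adjacent-respʳ-≐ (Adjacent-sym adj) (≐-sym e))

  delete : ArcSet n → Fin n → Fin n → ArcSet n
  delete T a b x y = if does (same? x y a b) then false else T x y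

  delete-inv : ∀ T a b {x y} → delete T a b x y ≡ true → ¬ (x ≡ a × y ≡ b) × T x y ≡ true
  delete-inv T a b {x} {y} Dxy with same? x y a b
  ... | no ≢ab = ≢ab , Dxy

  InV-delete : ∀ T a b {y} → InV (delete T a b) y → InV T y
  InV-delete T a b (z , inj₁ Dyz) = z , inj₁ (proj₂ (delete-inv T a b Dyz))
  InV-delete T a b (z , inj₂ Dzy) = z , inj₂ (proj₂ (delete-inv T a b Dzy))

  replace : ArcSet n → (a b c d : Fin n) → ArcSet n
  replace T a b c d x y = if does (same? x y c d) then true else delete T a b x y

  module _ (T : ArcSet n) (a b c d : Fin n) where

    replace-new : replace T a b c d c d ≡ true
    replace-new rewrite dec-true (same? c d c d) (refl , refl) = refl

    replace-keep : ∀ {x y} → ¬ (x ≡ a × y ≡ b) → T x y ≡ true → replace T a b c d x y ≡ true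
    replace-keep {x} {y} ≢ab Txy with does (same? x y c d)
    ... | true  = refl
    ... | false rewrite dec-false (same? x y a b) ≢ab = Txy

    replace-inv : ∀ x y → replace T a b c d x y ≡ true →
                  (x ≡ c × y ≡ d) ⊎ (¬ (x ≡ a × y ≡ b) × T x y ≡ true)
    replace-inv x y Nxy with same? x y c d
    ... | yes ≡cd = inj₁ ≡cd
    ... | no _    = inj₂ (delete-inv T a b Nxy)

    InV-replace : ∀ y → InV (replace T a b c d) y → (y ≡ c ⊎ y ≡ d) ⊎ InV (delete T a b) y
    InV-replace y (z , inj₁ Nyz) with same? y z c d
    ... | yes (y≡c , _) = inj₁ (inj₁ y≡c)
    ... | no _          = inj₂ (z , inj₁ Nyz)
    InV-replace y (z , inj₂ Nzy) with same? z y c d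
    ... | yes (_ , y≡d) = inj₁ (inj₂ y≡d)
    ... | no _          = inj₂ (z , inj₂ Nzy)

    module _ (Tab : T a b ≡ true) (Tcd : T c d ≡ false) where

      private
        cd≢ab : ¬ (c ≡ a × d ≡ b)
        cd≢ab (refl , refl) with () ← trans (sym Tab) Tcd

        delete-other : ∀ {x y} → ¬ (x ≡ a × y ≡ b) → delete T a b x y ≡ T x y
        delete-other {x} {y} ≢ab rewrite dec-false (same? x y a b) ≢ab = refl

        delete-at : delete T a b a b ≡ false
        delete-at rewrite dec-true (same? a b a b) (refl , refl) = refl

      ∣∣ₐ-replace : ∣ replace T a b c d ∣ₐ ≡ ∣ T ∣ₐ
      ∣∣ₐ-replace = trans (∣∣ₐ-insert c d replace-other (trans (delete-other cd≢ab) Tcd) replace-new)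
                          (sym (∣∣ₐ-insert a b (λ x y → delete-other) delete-at Tab))
        where
          replace-other : ∀ x y → ¬ (x ≡ c × y ≡ d) → delete T a b x y ≡ replace T a b c d x y
          replace-other x y ≢cd rewrite dec-false (same? x y c d) ≢cd = refl

      replace-removed : (T ∖ replace T a b c d) ≐ arc a b
      replace-removed x y with same? x y c d | same? x y a b
      ... | yes (refl , refl) | yes ≡ab = ⊥-elim (cd≢ab ≡ab)
      ... | yes (refl , refl) | no _    = Bool.∧-zeroʳ (T c d)
      ... | no _ | yes (refl , refl)    = trans (Bool.∧-identityʳ (T a b)) Tab
      ... | no _ | no _                 = Bool.∧-inverseʳ (T x y)

      replace-added : (replace T a b c d ∖ T) ≐ arc c d
      replace-added x y with same? x y c d | same? x y a b
      ... | yes (refl , refl) | _ = cong not Tcd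
      ... | no _ | yes _          = refl
      ... | no _ | no _           = Bool.∧-inverseʳ (T x y)

      replace-adjacent : Adjacent T (replace T a b c d)
      replace-adjacent = adjacent (trans (∣∣ₐ-cong replace-removed) (∣arc∣ₐ a b))
                                  (trans (∣∣ₐ-cong replace-added) (∣arc∣ₐ c d))

-- Directed trees as ranked trees

module _ {n : ℕ} where

  record RankedTree (T : ArcSet n) (r : Fin n) : Set where
    field
      rank            : Fin n → ℕ
      rank-<          : ∀ {x y} → T x y ≡ true → rank x < rank y
      parent-unique   : ∀ {x x′ y} → T x y ≡ true → T x′ y ≡ true → x ≡ x′
      root-parentless : ∀ {x} → ¬ T x r ≡ true
      parent          : ∀ y → InV T y → ¬ y ≡ r → ∃ λ x → T x y ≡ true
      root∈V          : InV T r

  _++ᵘ_ : ∀ {T : ArcSet n} {x y z} → UWalk T x y → UWalk T y z → UWalk T x z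
  []      ++ᵘ v = v
  fwd t w ++ᵘ v = fwd t (w ++ᵘ v)
  bwd t w ++ᵘ v = bwd t (w ++ᵘ v)

  reverseᵘ : ∀ {T : ArcSet n} {x y} → UWalk T x y → UWalk T y x
  reverseᵘ []        = []
  reverseᵘ (fwd t w) = reverseᵘ w ++ᵘ bwd t []
  reverseᵘ (bwd t w) = reverseᵘ w ++ᵘ fwd t []

  InV? : ∀ T x → Dec (InV {n} T x)
  InV? T x = any? λ y → (T x y Bool.≟ true) ⊎-dec (T y x Bool.≟ true)

  ∈V⇒≢ : ∀ {T : ArcSet n} {x y} → InV T x → ¬ InV T y → ¬ x ≡ y
  ∈V⇒≢ x∈V y∉V refl = y∉V x∈V

  InV-walk-end : ∀ {T : ArcSet n} {x y} → InV T x → UWalk T x y → InV T y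
  InV-walk-end x∈V []        = x∈V
  InV-walk-end _   (fwd t w) = InV-walk-end (_ , inj₂ t) w
  InV-walk-end _   (bwd t w) = InV-walk-end (_ , inj₁ t) w

  walk-to-root : ∀ {T : ArcSet n} {r} (rank : Fin n → ℕ) → (∀ {x y} → T x y ≡ true → rank x < rank y) →
                 (∀ y → InV T y → ¬ y ≡ r → ∃ λ x → T x y ≡ true) → ∀ x → InV T x → UWalk T x r
  walk-to-root {T} {r} rank rank-< parent x x∈V = climb (suc (rank x)) x ≤-refl x∈V
    where
      climb : ∀ fuel y → rank y < fuel → InV T y → UWalk T y r
      climb (suc fuel) y y<fuel y∈V with y ≟ r
      ... | yes refl = []
      ... | no y≢r with p , Tpy ← parent y y∈V y≢r =
        bwd Tpy (climb fuel p (≤-trans (rank-< Tpy) (≤-pred y<fuel)) (y , inj₁ Tpy))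

  InV-resp-≐ : ∀ {S S′ : ArcSet n} {x} → S ≐ S′ → InV S′ x → InV S x
  InV-resp-≐ e (y , inj₁ S′xy) = y , inj₁ (trans (e _ y) S′xy)
  InV-resp-≐ e (y , inj₂ S′yx) = y , inj₂ (trans (e y _) S′yx)

  distinct-roots⇒≉ : ∀ {T T′ u v} → RankedTree T u → RankedTree T′ v → ¬ u ≡ v → ¬ T ≐ T′
  distinct-roots⇒≉ {v = v} R R′ u≢v T≐T′ =
    let p , Tpv = RankedTree.parent R v (InV-resp-≐ T≐T′ (RankedTree.root∈V R′)) (u≢v ∘ sym)
    in RankedTree.root-parentless R′ (trans (sym (T≐T′ p v)) Tpv)

  module RankedTreeProperties {T : ArcSet n} {r : Fin n} (R : RankedTree T r) where
    open RankedTree R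

    connected : ∀ x y → InV T x → InV T y → UWalk T x y
    connected x y x∈V y∈V = to-root x x∈V ++ᵘ reverseᵘ (to-root y y∈V)
      where to-root = walk-to-root rank rank-< parent

    indeg≡1 : ∀ x → InV T x → ¬ x ≡ r → indeg T x ≡ 1
    indeg≡1 x x∈V x≢r with p , Tpx ← parent x x∈V x≢r =
      trans (indeg≡count T x) (count-one (λ y → T y x) p Tpx (λ y Tyx → parent-unique Tyx Tpx))

    -- Once a walk with distinct arcs has entered a vertex along its parent arc,
    -- it can never step backwards again, so ranks only grow.
    entered-walk-ascends : ∀ {p a b} (w : UWalk T a b) → Unique (uarcs w) →
                           T p a ≡ true → (p , a) ∉ᴬ uarcs w → rank a ≤ rank b
    entered-walk-ascends []          _         _   _            = ≤-refl
    entered-walk-ascends (fwd Tay w) (ay∉w ∷ u) _  _            =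
      ≤-trans (<⇒≤ (rank-< Tay)) (entered-walk-ascends w u Tay ay∉w)
    entered-walk-ascends (bwd Tya w) _         Tpa (pa≢ya ∷ _)  with refl ← parent-unique Tpa Tya =
      ⊥-elim (pa≢ya refl)

    entry-arc≡parent-arc : ∀ {a y q b} (w : UWalk T y b) → T a y ≡ true → (a , y) ∉ᴬ uarcs w →
                           Unique (uarcs w) → T q b ≡ true → (q , b) ∉ᴬ uarcs w → (a , y) ≡ (q , b)
    entry-arc≡parent-arc [] Tay _ _ Tqb _ with refl ← parent-unique Tay Tqb = refl
    entry-arc≡parent-arc (bwd Tzy w) Tay (ay≢zy ∷ _) _ _ _ with refl ← parent-unique Tay Tzy =
      ⊥-elim (ay≢zy refl)
    entry-arc≡parent-arc (fwd Tyz w) _ _ (yz∉w ∷ u) Tqb (qb≢yz ∷ qb∉w) =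
      ⊥-elim (qb≢yz (sym (entry-arc≡parent-arc w Tyz yz∉w u Tqb qb∉w)))

    walk-into-unused-parent-descends : ∀ {a q b} (w : UWalk T a b) → Unique (uarcs w) →
                                       T q b ≡ true → (q , b) ∉ᴬ uarcs w → rank b ≤ rank a
    walk-into-unused-parent-descends [] _ _ _ = ≤-refl
    walk-into-unused-parent-descends (bwd Tza w) (_ ∷ u) Tqb (_ ∷ qb∉w) =
      ≤-trans (walk-into-unused-parent-descends w u Tqb qb∉w) (<⇒≤ (rank-< Tza))
    walk-into-unused-parent-descends (fwd Taz w) (az∉w ∷ u) Tqb (qb≢az ∷ qb∉w) =
      ⊥-elim (qb≢az (sym (entry-arc≡parent-arc w Taz az∉w u Tqb qb∉w)))

    acyclic : ¬ UCycle T
    acyclic (x , fwd Txy w , _ , xy∉w ∷ u , _) =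
      <-irrefl refl (<-≤-trans (rank-< Txy) (entered-walk-ascends w u Txy xy∉w))
    acyclic (x , bwd Tyx w , _ , yx∉w ∷ u , _) =
      <-irrefl refl (<-≤-trans (rank-< Tyx) (walk-into-unused-parent-descends w u Tyx yx∉w))

    isDirTree : IsDirTree T r
    isDirTree = (connected , acyclic) , root∈V , indeg≡1

  dwalk⇒uwalk : ∀ {T : ArcSet n} {x y} → DWalk T x y → UWalk T x y
  dwalk⇒uwalk []      = []
  dwalk⇒uwalk (t ∷ w) = fwd t (dwalk⇒uwalk w)

  All-dverts-head : ∀ {T : ArcSet n} {x y} {P : Fin n → Set} (w : DWalk T x y) → All P (dverts w) → P x
  All-dverts-head []      (Px ∷ _) = Px
  All-dverts-head (_ ∷ _) (Px ∷ _) = Px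

  module _ {T : ArcSet n} where

    private
      All-ustarts : ∀ {x y} {P : Fin n → Set} (w : DWalk T x y) → All P (dverts w) →
                    All P (ustarts (dwalk⇒uwalk w)) × P y
      All-ustarts []      (Py ∷ [])  = [] , Py
      All-ustarts (_ ∷ w) (Px ∷ Pw) with Pst , Py ← All-ustarts w Pw = Px ∷ Pst , Py

      Unique-ustarts : ∀ {x y} (w : DWalk T x y) → Unique (dverts w) →
                       Unique (ustarts (dwalk⇒uwalk w)) × y ∉ᴬ ustarts (dwalk⇒uwalk w)
      Unique-ustarts []      _           = [] , []
      Unique-ustarts (_ ∷ w) (x∉w ∷ u)
        with u′ , y∉ ← Unique-ustarts w u | x∉st , x≢y ← All-ustarts w x∉w =
        x∉st ∷ u′ , (x≢y ∘ sym) ∷ y∉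

      ∉-uarcs : ∀ {x y} p z (w : DWalk T x y) →
                p ∉ᴬ ustarts (dwalk⇒uwalk w) → (p , z) ∉ᴬ uarcs (dwalk⇒uwalk w)
      ∉-uarcs p z []      []           = []
      ∉-uarcs p z (_ ∷ w) (p≢x ∷ p∉w) = (p≢x ∘ cong proj₁) ∷ ∉-uarcs p z w p∉w

      Unique-uarcs : ∀ {x y} (w : DWalk T x y) → Unique (ustarts (dwalk⇒uwalk w)) → Unique (uarcs (dwalk⇒uwalk w))
      Unique-uarcs []      _           = []
      Unique-uarcs (_∷_ {x} {y} _ w) (x∉w ∷ u) = ∉-uarcs x y w x∉w ∷ Unique-uarcs w u

    path+arc⇒UCycle : ∀ {z p} → T p z ≡ true → (w : DWalk T z p) → Unique (dverts w) → UCycle T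
    path+arc⇒UCycle {z} {p} Tpz w u with u′ , p∉ ← Unique-ustarts w u =
      p , fwd Tpz (dwalk⇒uwalk w) , s≤s z≤n , ∉-uarcs p z w p∉ ∷ Unique-uarcs w u′ , p∉ ∷ u′

    prefix : ∀ {z y p} (w : DWalk T z y) → Unique (dverts w) → p ∈ dverts w →
             Σ (DWalk T z p) λ w′ → Unique (dverts w′) × (∀ {a} → a ∈ dverts w′ → a ∈ dverts w)
    prefix []      _ (here refl) = [] , [] ∷ [] , λ a∈ → a∈
    prefix (_ ∷ w) _ (here refl) = [] , [] ∷ [] , λ { (here refl) → here refl }
    prefix (t ∷ w) (x∉w ∷ u) (there p∈w) with w′ , u′ , w′⊆w ← prefix w u p∈w =
      t ∷ w′ , All.tabulate (All.lookup x∉w ∘ w′⊆w) ∷ u′ ,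
      λ { (here refl) → here refl ; (there a∈) → there (w′⊆w a∈) }

  open DecMembership (_≟_ {n}) using (_∈?_)

  module DirTreeRanking {T : ArcSet n} {r : Fin n} (D : IsDirTree T r) where

    private
      acyclic : ¬ UCycle T
      acyclic = proj₂ (proj₁ D)

      indeg≡1 : ∀ y → InV T y → ¬ y ≡ r → count (λ x → T x y) ≡ 1
      indeg≡1 y y∈V y≢r = trans (sym (indeg≡count T y)) (proj₂ (proj₂ D) y y∈V y≢r)

      parent-unique′ : ∀ {x x′ y} → ¬ y ≡ r → T x y ≡ true → T x′ y ≡ true → x ≡ x′
      parent-unique′ {x} {x′} {y} y≢r Txy Tx′y with x ≟ x′
      ... | yes x≡x′ = x≡x′
      ... | no x≢x′  = ⊥-elim (<-irrefl refl (≤-trans (count-two (λ z → T z y) x x′ x≢x′ Txy Tx′y)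
                                                      (≤-reflexive (indeg≡1 y (x , inj₂ Txy) y≢r))))

    parent : ∀ y → InV T y → ¬ y ≡ r → ∃ λ x → T x y ≡ true
    parent y y∈V y≢r = count-pos (λ x → T x y) (≤-reflexive (sym (indeg≡1 y y∈V y≢r)))

    depth : ℕ → Fin n → ℕ
    depth zero    y = 0
    depth (suc g) y with y ≟ r
    ... | yes _ = 0
    ... | no _ with any? (λ x → T x y Bool.≟ true)
    ... | yes (p , _) = suc (depth g p)
    ... | no _        = 0

    depth-root : ∀ g → depth g r ≡ 0
    depth-root zero = refl
    depth-root (suc g) with r ≟ r
    ... | yes _   = refl
    ... | no r≢r  = ⊥-elim (r≢r refl)

    depth-step : ∀ g {p y} → ¬ y ≡ r → T p y ≡ true → depth (suc g) y ≡ suc (depth g p)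
    depth-step g {p} {y} y≢r Tpy with y ≟ r
    ... | yes y≡r = ⊥-elim (y≢r y≡r)
    ... | no _ with any? (λ x → T x y Bool.≟ true)
    ... | yes (p′ , Tp′y) rewrite parent-unique′ y≢r Tp′y Tpy = refl
    ... | no none = ⊥-elim (none (p , Tpy))

    -- Climbing parent arcs from z on top of the path w already climbed: acyclicity forbids
    -- revisiting a vertex of w, so r is reached before the fuel runs out, and from then on
    -- depth no longer depends on the fuel.
    climb : ∀ f {z y} (w : DWalk T z y) → Unique (dverts w) → InV T z → n < length (dverts w) + f →
            (Σ (DWalk T r y) λ w′ → Unique (dverts w′)) × (∀ g → f ≤ g → depth g z ≡ depth f z)
    climb f {z} w u z∈V bound with z ≟ r
    ... | yes refl = (w , u) , λ g _ → trans (depth-root g) (sym (depth-root f))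
    ... | no z≢r with p , Tpz ← parent z z∈V z≢r with p ∈? dverts w
    ... | yes p∈w with w′ , u′ , _ ← prefix w u p∈w = ⊥-elim (acyclic (path+arc⇒UCycle Tpz w′ u′))
    ... | no p∉w with f
    ... | zero =
      ⊥-elim (<-irrefl refl (<-≤-trans (subst (n <_) (+-identityʳ _) bound) (Unique⇒length≤ (dverts w) u)))
    ... | suc f
      with root-path , stable ← climb f (Tpz ∷ w) (¬Any⇒All¬ _ p∉w ∷ u) (z , inj₁ Tpz)
                                       (subst (n <_) (+-suc _ f) bound) =
      root-path , λ { (suc g) (s≤s f≤g) → begin
        depth (suc g) z     ≡⟨ depth-step g z≢r Tpz ⟩
        suc (depth g p)     ≡⟨ cong suc (stable g f≤g) ⟩
        suc (depth f p)     ≡⟨ depth-step f z≢r Tpz ⟨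
        depth (suc f) z     ∎ }
      where open ≡-Reasoning

    private
      climb-from : ∀ y → InV T y →
                   (Σ (DWalk T r y) λ w → Unique (dverts w)) × (∀ g → n ≤ g → depth g y ≡ depth n y)
      climb-from y y∈V = climb n [] ([] ∷ []) y∈V (n<1+n n)

      root-parentless : ∀ {x} → ¬ T x r ≡ true
      root-parentless Txr with (w , u) , _ ← climb-from _ (r , inj₁ Txr) = acyclic (path+arc⇒UCycle Txr w u)

      rank-< : ∀ {x y} → T x y ≡ true → depth (suc n) x < depth (suc n) y
      rank-< {x} {y} Txy = subst₂ _<_ (sym (proj₂ (climb-from x (y , inj₁ Txy)) (suc n) (n≤1+n n)))
                                      (sym (depth-step n y≢r Txy)) (n<1+n _)
        where y≢r : ¬ y ≡ r
              y≢r refl = root-parentless Txy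

      parent-unique : ∀ {x x′ y} → T x y ≡ true → T x′ y ≡ true → x ≡ x′
      parent-unique {y = y} Txy Tx′y with y ≟ r
      ... | yes refl = ⊥-elim (root-parentless Txy)
      ... | no y≢r   = parent-unique′ y≢r Txy Tx′y

    rankedTree : RankedTree T r
    rankedTree = record
      { rank = depth (suc n) ; rank-< = rank-< ; parent-unique = parent-unique
      ; root-parentless = root-parentless ; parent = parent ; root∈V = proj₁ (proj₂ D) }

  -- Exchanging one arc of a directed tree

  module _ {T : ArcSet n} {r : Fin n} (R : RankedTree T r) {a b c d : Fin n} where
    private
      module R = RankedTree R
      N = replace T a b c d

    -- In the new tree d gets parent c and every other non-root vertex keeps its parent from T,
    -- so what remains to be checked is a ranking, that (a , b) was the only arc into d,
    -- and that the new root r′ has no parent.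
    replace-rankedTree : ∀ {r′} (rank′ : Fin n → ℕ) →
                         (∀ {x y} → N x y ≡ true → rank′ x < rank′ y) →
                         (∀ {p} → T p d ≡ true → p ≡ a × d ≡ b) →
                         (∀ p → ¬ N p r′ ≡ true) →
                         (∀ y → InV N y → ¬ y ≡ r′ → ¬ y ≡ d → InV T y × ¬ y ≡ r × ¬ y ≡ b) →
                         RankedTree N r′
    replace-rankedTree {r′} rank′ rank′-< only-into-d r′-parentless others = record
      { rank = rank′ ; rank-< = rank′-< ; parent-unique = parent-unique ; root-parentless = λ {x} → r′-parentless x
      ; parent = parent ; root∈V = InV-walk-end c∈V (walk-to-root rank′ rank′-< parent c c∈V) }
      where
        c∈V : InV N c
        c∈V = d , inj₁ (replace-new T a b c d)

        parent-unique : ∀ {x x′ y} → N x y ≡ true → N x′ y ≡ true → x ≡ x′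
        parent-unique {x} {x′} {y} Nxy Nx′y with replace-inv T a b c d x y Nxy | replace-inv T a b c d x′ y Nx′y
        ... | inj₁ (refl , refl) | inj₁ (refl , _)     = refl
        ... | inj₁ (refl , refl) | inj₂ (≢ab , Tx′d)   = ⊥-elim (≢ab (only-into-d Tx′d))
        ... | inj₂ (≢ab , Txd)   | inj₁ (_ , refl)     = ⊥-elim (≢ab (only-into-d Txd))
        ... | inj₂ (_ , Txy)     | inj₂ (_ , Tx′y)     = R.parent-unique Txy Tx′y

        parent : ∀ y → InV N y → ¬ y ≡ r′ → ∃ λ x → N x y ≡ true
        parent y y∈V y≢r′ = parent-by (y ≟ d)
          where
            parent-by : Dec (y ≡ d) → ∃ λ x → N x y ≡ true
            parent-by (yes y≡d) = c , subst (λ y → N c y ≡ true) (sym y≡d) (replace-new T a b c d)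
            parent-by (no y≢d) with y∈Vᵀ , y≢r , y≢b ← others y y∈V y≢r′ y≢d
                               with p , Tpy ← R.parent y y∈Vᵀ y≢r =
              p , replace-keep T a b c d (y≢b ∘ proj₂) Tpy

  data Descendant (T : ArcSet n) (b : Fin n) : Fin n → Set where
    self  : Descendant T b b
    child : ∀ {z w} → T z w ≡ true → Descendant T b z → Descendant T b w

  module TreeOperations {T : ArcSet n} {r : Fin n} (R : RankedTree T r) where
    open RankedTree R

    has-parent? : ∀ y → Dec (∃ λ x → T x y ≡ true)
    has-parent? y = any? (λ x → T x y Bool.≟ true)

    parent-of-descendant : ∀ {b p w} → Descendant T b w → T p w ≡ true → ¬ w ≡ b → Descendant T b p
    parent-of-descendant self          _   w≢b = ⊥-elim (w≢b refl)
    parent-of-descendant (child Tzw z) Tpw _   with refl ← parent-unique Tzw Tpw = z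

    not-descendant-child : ∀ {q x p w} → T q x ≡ true → T p w ≡ true → ¬ (p ≡ q × w ≡ x) →
                           ¬ Descendant T x p → ¬ Descendant T x w
    not-descendant-child {x = x} {w = w} Tqx Tpw ≢qx p-nondesc w-desc with w ≟ x
    ... | yes refl = ≢qx (parent-unique Tpw Tqx , refl)
    ... | no w≢x   = p-nondesc (parent-of-descendant w-desc Tpw w≢x)

    descendant? : ∀ b w → Dec (Descendant T b w)
    descendant? b w = decide (suc (rank w)) w ≤-refl
      where
        decide : ∀ fuel w → rank w < fuel → Dec (Descendant T b w)
        decide (suc fuel) w w<fuel with w ≟ b
        ... | yes refl = yes self
        ... | no w≢b with has-parent? w
        ... | no none = no λ { self → w≢b refl ; (child Tzw _) → none (_ , Tzw) }
        ... | yes (p , Tpw) with decide fuel p (≤-trans (rank-< Tpw) (≤-pred w<fuel))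
        ... | yes p-desc    = yes (child Tpw p-desc)
        ... | no p-nondesc  = no (p-nondesc ∘ λ w-desc → parent-of-descendant w-desc Tpw w≢b)

    descendant-of-root : ∀ {b} → Descendant T b r → b ≡ r
    descendant-of-root self          = refl
    descendant-of-root (child Tzr _) = ⊥-elim (root-parentless Tzr)

    leaf-isolated : ∀ {a ℓ} → T a ℓ ≡ true → (∀ z → T ℓ z ≡ false) → ¬ InV (delete T a ℓ) ℓ
    leaf-isolated {a} {ℓ} _ leaf (z , inj₁ Dℓz) with () ← trans (sym (proj₂ (delete-inv T a ℓ Dℓz))) (leaf z)
    leaf-isolated {a} {ℓ} Taℓ _ (z , inj₂ Dzℓ) with ≢aℓ , Tzℓ ← delete-inv T a ℓ Dzℓ =
      ≢aℓ (parent-unique Tzℓ Taℓ , refl)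

    move-leaf : ∀ {a ℓ c d} → T a ℓ ≡ true → (∀ z → T ℓ z ≡ false) →
                InV T c → ¬ c ≡ ℓ → ¬ InV T d →
                RankedTree (replace T a ℓ c d) r
    move-leaf {a} {ℓ} {c} {d} Taℓ leaf c∈V c≢ℓ d∉V =
      replace-rankedTree R rank′ rank′-< (λ Tpd → ⊥-elim (d∉V (_ , inj₂ Tpd))) r-parentless others
      where
        rank′ : Fin n → ℕ
        rank′ z = if does (z ≟ d) then suc (rank c) else rank z

        rank′-< : ∀ {x y} → replace T a ℓ c d x y ≡ true → rank′ x < rank′ y
        rank′-< {x} {y} Nxy with replace-inv T a ℓ c d x y Nxy
        ... | inj₁ (refl , refl) rewrite dec-false (c ≟ d) (∈V⇒≢ c∈V d∉V) | dec-true (d ≟ d) refl = ≤-refl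
        ... | inj₂ (_ , Txy) rewrite dec-false (x ≟ d) (∈V⇒≢ (y , inj₁ Txy) d∉V)
                                   | dec-false (y ≟ d) (∈V⇒≢ (x , inj₂ Txy) d∉V) = rank-< Txy

        r-parentless : ∀ p → ¬ replace T a ℓ c d p r ≡ true
        r-parentless p Npr with replace-inv T a ℓ c d p r Npr
        ... | inj₁ (_ , refl) = d∉V root∈V
        ... | inj₂ (_ , Tpr)  = root-parentless Tpr

        others : ∀ y → InV (replace T a ℓ c d) y → ¬ y ≡ r → ¬ y ≡ d →
                 InV T y × ¬ y ≡ r × ¬ y ≡ ℓ
        others y y∈V y≢r y≢d with InV-replace T a ℓ c d y y∈V
        ... | inj₁ (inj₁ refl) = c∈V , y≢r , c≢ℓ
        ... | inj₁ (inj₂ y≡d)  = ⊥-elim (y≢d y≡d)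
        ... | inj₂ y∈V′        =
          InV-delete T a ℓ y∈V′ , y≢r , λ { refl → leaf-isolated Taℓ leaf y∈V′ }

    root-at-new-vertex : ∀ {a ℓ x} → T a ℓ ≡ true → (∀ z → T ℓ z ≡ false) → ¬ InV T x →
                         RankedTree (replace T a ℓ x r) x
    root-at-new-vertex {a} {ℓ} {x} Taℓ leaf x∉V =
      replace-rankedTree R rank′ rank′-< (⊥-elim ∘ root-parentless) x-parentless others
      where
        rank′ : Fin n → ℕ
        rank′ z = if does (z ≟ x) then 0 else suc (rank z)

        rank′-< : ∀ {p q} → replace T a ℓ x r p q ≡ true → rank′ p < rank′ q
        rank′-< {p} {q} Npq with replace-inv T a ℓ x r p q Npq
        ... | inj₁ (refl , refl) rewrite dec-true (x ≟ x) refl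
                                       | dec-false (r ≟ x) (∈V⇒≢ root∈V x∉V) = s≤s z≤n
        ... | inj₂ (_ , Tpq) rewrite dec-false (p ≟ x) (∈V⇒≢ (q , inj₁ Tpq) x∉V)
                                   | dec-false (q ≟ x) (∈V⇒≢ (p , inj₂ Tpq) x∉V) = s≤s (rank-< Tpq)

        x-parentless : ∀ p → ¬ replace T a ℓ x r p x ≡ true
        x-parentless p Npx with replace-inv T a ℓ x r p x Npx
        ... | inj₁ (_ , refl) = x∉V root∈V
        ... | inj₂ (_ , Tpx)  = x∉V (_ , inj₂ Tpx)

        others : ∀ y → InV (replace T a ℓ x r) y → ¬ y ≡ x → ¬ y ≡ r →
                 InV T y × ¬ y ≡ r × ¬ y ≡ ℓ
        others y y∈V y≢x y≢r with InV-replace T a ℓ x r y y∈V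
        ... | inj₁ (inj₁ y≡x) = ⊥-elim (y≢x y≡x)
        ... | inj₁ (inj₂ y≡r) = ⊥-elim (y≢r y≡r)
        ... | inj₂ y∈V′       =
          InV-delete T a ℓ y∈V′ , y≢r , λ { refl → leaf-isolated Taℓ leaf y∈V′ }

    -- Cutting the subtree of x off its parent q and hanging the rest of the tree below x.
    root-at : ∀ {q x} → T q x ≡ true → ¬ x ≡ r → RankedTree (replace T q x x r) x
    root-at {q} {x} Tqx x≢r = replace-rankedTree R rank′ rank′-< (⊥-elim ∘ root-parentless) x-parentless others
      where
        rank′ : Fin n → ℕ
        rank′ z = if does (descendant? x z) then rank z else rank z + suc (rank x)

        rank′-< : ∀ {p w} → replace T q x x r p w ≡ true → rank′ p < rank′ w
        rank′-< {p} {w} Npw with replace-inv T q x x r p w Npw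
        ... | inj₁ (refl , refl) rewrite dec-true (descendant? x x) self
                                       | dec-false (descendant? x r) (x≢r ∘ descendant-of-root) = m≤n+m _ (rank r)
        ... | inj₂ (≢qx , Tpw) with descendant? x p
        ...   | yes p-desc rewrite dec-true (descendant? x w) (child Tpw p-desc) = rank-< Tpw
        ...   | no p-nondesc rewrite dec-false (descendant? x w) (not-descendant-child Tqx Tpw ≢qx p-nondesc) =
          +-monoˡ-< (suc (rank x)) (rank-< Tpw)

        x-parentless : ∀ p → ¬ replace T q x x r p x ≡ true
        x-parentless p Npx with replace-inv T q x x r p x Npx
        ... | inj₁ (_ , x≡r)  = x≢r x≡r
        ... | inj₂ (≢qx , Tpx) = ≢qx (parent-unique Tpx Tqx , refl)

        others : ∀ y → InV (replace T q x x r) y → ¬ y ≡ x → ¬ y ≡ r → InV T y × ¬ y ≡ r × ¬ y ≡ x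
        others y y∈V y≢x y≢r with InV-replace T q x x r y y∈V
        ... | inj₁ (inj₁ y≡x) = ⊥-elim (y≢x y≡x)
        ... | inj₁ (inj₂ y≡r) = ⊥-elim (y≢r y≡r)
        ... | inj₂ y∈V′       = InV-delete T q x y∈V′ , y≢r , y≢x

    rehang : ∀ {c b a} → T c b ≡ true → ¬ b ≡ r → InV T a → ¬ Descendant T b a →
             RankedTree (replace T c b a b) r
    rehang {c} {b} {a} Tcb b≢r a∈V a-nondesc =
      replace-rankedTree R rank′ rank′-< (λ Tpb → parent-unique Tpb Tcb , refl) r-parentless others
      where
        rank′ : Fin n → ℕ
        rank′ z = if does (descendant? b z) then rank z + suc (rank a) else rank z

        rank′-< : ∀ {p w} → replace T c b a b p w ≡ true → rank′ p < rank′ w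
        rank′-< {p} {w} Npw with replace-inv T c b a b p w Npw
        ... | inj₁ (refl , refl) rewrite dec-false (descendant? b a) a-nondesc
                                       | dec-true (descendant? b b) self = m≤n+m _ (rank b)
        ... | inj₂ (≢cb , Tpw) with descendant? b p
        ...   | yes p-desc rewrite dec-true (descendant? b w) (child Tpw p-desc) = +-monoˡ-< (suc (rank a)) (rank-< Tpw)
        ...   | no p-nondesc rewrite dec-false (descendant? b w) (not-descendant-child Tcb Tpw ≢cb p-nondesc) =
          rank-< Tpw

        r-parentless : ∀ p → ¬ replace T c b a b p r ≡ true
        r-parentless p Npr with replace-inv T c b a b p r Npr
        ... | inj₁ (_ , r≡b) = b≢r (sym r≡b)
        ... | inj₂ (_ , Tpr) = root-parentless Tpr

        others : ∀ y → InV (replace T c b a b) y → ¬ y ≡ r → ¬ y ≡ b → InV T y × ¬ y ≡ r × ¬ y ≡ b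
        others y y∈V y≢r y≢b with InV-replace T c b a b y y∈V
        ... | inj₁ (inj₁ refl) = a∈V , y≢r , y≢b
        ... | inj₁ (inj₂ y≡b)  = ⊥-elim (y≢b y≡b)
        ... | inj₂ y∈V′        = InV-delete T c b y∈V′ , y≢r , y≢b

    descendant∈V : ∀ {b w} → InV T b → Descendant T b w → InV T w
    descendant∈V b∈V self          = b∈V
    descendant∈V _   (child Tzw _) = _ , inj₂ Tzw

    leaf-below : ∀ {x y} → T x y ≡ true →
                 ∃ λ a → ∃ λ ℓ → T a ℓ ≡ true × (∀ z → T ℓ z ≡ false) × Descendant T y ℓ
    leaf-below {x} {y} Txy = deepest (argmax-of rank (descendant? y) self)
      where
        deepest : ∃ (λ ℓ → Descendant T y ℓ × (∀ w → Descendant T y w → rank w ≤ rank ℓ)) →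
                  ∃ λ a → ∃ λ ℓ → T a ℓ ≡ true × (∀ z → T ℓ z ≡ false) × Descendant T y ℓ
        deepest (ℓ , ℓ-desc , ℓ-deepest) =
          let a , Taℓ = parent ℓ (descendant∈V (x , inj₂ Txy) ℓ-desc) ℓ≢r in a , ℓ , Taℓ , leaf , ℓ-desc
          where
            ℓ≢r : ¬ ℓ ≡ r
            ℓ≢r refl with refl ← descendant-of-root ℓ-desc = root-parentless Txy

            leaf : ∀ z → T ℓ z ≡ false
            leaf z = Bool.¬-not λ Tℓz →
              <-irrefl refl (<-≤-trans (rank-< Tℓz) (ℓ-deepest z (child Tℓz ℓ-desc)))

  -- Chains of adjacent trees

  module TreesIn (G : Digraph n) (k : ℕ) where

    data Chain : ArcSet n → ArcSet n → Set where
      done : ∀ {T T′} → DirTreeIn G k T → DirTreeIn G k T′ → T ≐ T′ → Chain T T′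
      step : ∀ {T T₁ T′} → DirTreeIn G k T → Adjacent T T₁ → Chain T₁ T′ → Chain T T′

    private
      chain-resp-≐ : ∀ {T₀ T T′} → DirTreeIn G k T₀ → T₀ ≐ T → Chain T T′ → Chain T₀ T′
      chain-resp-≐ D₀ e (done _ D′ e′) = done D₀ D′ (≐-trans e e′)
      chain-resp-≐ D₀ e (step _ a c)   = step D₀ (Adjacent-respˡ-≐ e a) c

      chain-snoc : ∀ {T T′ T′′} → Chain T T′ → Adjacent T′ T′′ → DirTreeIn G k T′′ →
                   Chain T T′′
      chain-snoc (done D _ e) a D′′ = step D (Adjacent-respˡ-≐ e a) (done D′′ D′′ λ _ _ → refl)
      chain-snoc (step D a c) a′ D′′ = step D a (chain-snoc c a′ D′′)

    chain-reverse : ∀ {T T′} → Chain T T′ → Chain T′ T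
    chain-reverse (done D D′ e) = done D′ D (≐-sym e)
    chain-reverse (step D a c)  = chain-snoc (chain-reverse c) (Adjacent-sym a) D

    _++ᶜ_ : ∀ {T T′ T′′} → Chain T T′ → Chain T′ T′′ → Chain T T′′
    done D _ e ++ᶜ c′ = chain-resp-≐ D e c′
    step D a c ++ᶜ c′ = step D a (c ++ᶜ c′)

    steps : ∀ {T T′} → Chain T T′ → ℕ
    steps (done _ _ _) = 0
    steps (step _ _ c) = suc (steps c)

    -- The i-th tree of a chain; a chain without steps is read as its target, so that the
    -- last tree is T′ on the nose (T is only pointwise equal to it).
    _!_ : ∀ {T T′} (c : Chain T T′) → Fin (suc (steps c)) → ArcSet n
    _!_ {T′ = T′} (done _ _ _) _ = T′
    _!_ {T = T}   (step _ _ c) zero    = T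
    step _ _ c ! suc i = c ! i

    !-first : ∀ {T T′} (c : Chain T T′) → (c ! zero) ≐ T
    !-first (done _ _ e) = ≐-sym e
    !-first (step _ _ _) _ _ = refl

    !-last : ∀ {T T′} (c : Chain T T′) → c ! fromℕ (steps c) ≡ T′
    !-last (done _ _ _) = refl
    !-last (step _ _ c) = !-last c

    !-tree : ∀ {T T′} (c : Chain T T′) i → DirTreeIn G k (c ! i)
    !-tree (done _ D′ _) _       = D′
    !-tree (step D _ _)  zero    = D
    !-tree (step _ _ c)  (suc i) = !-tree c i

    !-adjacent : ∀ {T T′} (c : Chain T T′) (i : Fin (steps c)) → Adjacent (c ! inject₁ i) (c ! suc i)
    !-adjacent (step _ a c) zero    = Adjacent-respʳ-≐ a (≐-sym (!-first c))
    !-adjacent (step _ _ c) (suc i) = !-adjacent c i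

    chain⇒sequence : ∀ {T T′} → Chain T T′ → ¬ T ≐ T′ →
      Σ ℕ λ ℓ → Σ (Fin (suc ℓ) → ArcSet n) λ Ts →
        Ts zero ≡ T × Ts (fromℕ ℓ) ≡ T′ × (∀ i → DirTreeIn G k (Ts i)) ×
        (∀ (i : Fin ℓ) → ∣ Ts (inject₁ i) ∖ Ts (suc i) ∣ₐ ≡ 1
                       × ∣ Ts (suc i) ∖ Ts (inject₁ i) ∣ₐ ≡ 1)
    chain⇒sequence (done _ _ e) T≉T′ = ⊥-elim (T≉T′ e)
    chain⇒sequence c@(step _ _ _) _ =
      steps c , c !_ , refl , !-last c , !-tree c ,
      λ i → Adjacent.removed (!-adjacent c i) , Adjacent.added (!-adjacent c i)

    RootedTreeIn : Fin n → ArcSet n → Set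
    RootedTreeIn r T = T ⊆ₐ G × ∣ T ∣ₐ ≡ k × RankedTree T r

    RootedTreeIn⇒DirTreeIn : ∀ {r T} → RootedTreeIn r T → DirTreeIn G k T
    RootedTreeIn⇒DirTreeIn {r} (T⊆G , ∣T∣ , R) = T⊆G , ∣T∣ , r , RankedTreeProperties.isDirTree R

    replace-rootedTreeIn : ∀ {r r′ T a b c d} → RootedTreeIn r T →
                           T a b ≡ true → T c d ≡ false → G c d ≡ true →
                           RankedTree (replace T a b c d) r′ →
                           RootedTreeIn r′ (replace T a b c d) × Adjacent T (replace T a b c d)
    replace-rootedTreeIn {T = T} {a} {b} {c} {d} (T⊆G , ∣T∣ , _) Tab Tcd Gcd R′ =
      (N⊆G , trans (∣∣ₐ-replace T a b c d Tab Tcd) ∣T∣ , R′) , replace-adjacent T a b c d Tab Tcd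
      where
        N⊆G : replace T a b c d ⊆ₐ G
        N⊆G x y Nxy with replace-inv T a b c d x y Nxy
        ... | inj₁ (refl , refl) = Gcd
        ... | inj₂ (_ , Txy)     = T⊆G x y Txy

    reroot-at-tail : 1 ≤ k → ∀ {x y Y} → G x y ≡ true → ¬ x ≡ y → RootedTreeIn y Y →
                           Σ (ArcSet n) λ W → RootedTreeIn x W × Adjacent W Y
    reroot-at-tail 1≤k {x} {y} {Y} Gxy x≢y tY@(_ , ∣Y∣ , R) with InV? Y x
    ... | no x∉V
      with p , q , Ypq     ← ∣∣ₐ-pos Y (subst (1 ≤_) (sym ∣Y∣) 1≤k)
      with a , ℓ , Yaℓ , leaf , _ ← TreeOperations.leaf-below R Ypq
      with W , Y~W ← replace-rootedTreeIn tY Yaℓ (Bool.¬-not (x∉V ∘ (y ,_) ∘ inj₁)) Gxy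
                                          (TreeOperations.root-at-new-vertex R Yaℓ leaf x∉V)
      = _ , W , Adjacent-sym Y~W
    ... | yes x∈V
      with q , Yqx ← RankedTree.parent R x x∈V x≢y
      with W , Y~W ← replace-rootedTreeIn tY Yqx (Bool.¬-not (RankedTree.root-parentless R)) Gxy
                                          (TreeOperations.root-at R Yqx x≢y)
      = _ , W , Adjacent-sym Y~W

    reroot-along-path : 1 ≤ k → ∀ {x v T′} (w : DWalk G x v) → Unique (dverts w) → RootedTreeIn v T′ →
                                Σ (ArcSet n) λ W → RootedTreeIn x W × Chain W T′
    reroot-along-path 1≤k [] _ tT′ = _ , tT′ , done D D (λ _ _ → refl)
      where D = RootedTreeIn⇒DirTreeIn tT′
    reroot-along-path 1≤k (Gxy ∷ w) (x∉w ∷ u) tT′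
      with Y , tY , c ← reroot-along-path 1≤k w u tT′
      with W , tW , W~Y ← reroot-at-tail 1≤k Gxy (All-dverts-head w x∉w) tY
      = W , tW , step (RootedTreeIn⇒DirTreeIn tW) W~Y c

    -- The shared part of T is the largest subtree at r common to T and T′; each step of the
    -- chain from T to T′ adds one vertex to it.
    module SameRoot {r : Fin n} {T′ : ArcSet n} (tT′ : RootedTreeIn r T′) where
      private
        R′ = proj₂ (proj₂ tT′)
        module R′ = RankedTree R′

      data Shared (T : ArcSet n) : Fin n → Set where
        root   : Shared T r
        extend : ∀ {a b} → T′ a b ≡ true → T a b ≡ true → Shared T a → Shared T b

      shared-parent : ∀ {T b} → Shared T b → ¬ b ≡ r →
                      ∃ λ a → T′ a b ≡ true × T a b ≡ true × Shared T a
      shared-parent root               b≢r = ⊥-elim (b≢r refl)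
      shared-parent (extend T′ab Tab s) _ = _ , T′ab , Tab , s

      shared? : ∀ T b → Dec (Shared T b)
      shared? T b = decide (suc (R′.rank b)) b ≤-refl
        where
          decide : ∀ fuel b → R′.rank b < fuel → Dec (Shared T b)
          decide (suc fuel) b b<fuel with b ≟ r
          ... | yes refl = yes root
          ... | no b≢r with TreeOperations.has-parent? R′ b
          ... | no none = no λ s → let a , T′ab , _ = shared-parent s b≢r in none (a , T′ab)
          ... | yes (a , T′ab) with T a b Bool.≟ true | decide fuel a (≤-trans (R′.rank-< T′ab) (≤-pred b<fuel))
          ... | yes Tab | yes sa = yes (extend T′ab Tab sa)
          ... | yes _   | no ¬sa = no λ s → let a′ , T′a′b , _ , sa′ = shared-parent s b≢r in
                                              ¬sa (subst (Shared T) (R′.parent-unique T′a′b T′ab) sa′)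
          ... | no ¬Tab | _      = no λ s → let a′ , T′a′b , Ta′b , _ = shared-parent s b≢r in
                                              ¬Tab (subst (λ a → T a b ≡ true) (R′.parent-unique T′a′b T′ab) Ta′b)

      shared-count : ArcSet n → ℕ
      shared-count T = count (λ b → does (shared? T b))

      shared-count-< : ∀ {T N b} → (∀ {w} → Shared T w → Shared N w) → ¬ Shared T b → Shared N b →
                       shared-count T < shared-count N
      shared-count-< {T} {N} {b} T⊆N ¬sb sb′ =
        count-mono-< (λ w s → dec-true (shared? N w) (T⊆N (dec-true⁻¹ (shared? T w) s))) b
                     (dec-false (shared? T b) ¬sb) (dec-true (shared? N b) sb′)

      Closer : ArcSet n → Set
      Closer T = Σ (ArcSet n) λ N → RootedTreeIn r N × Adjacent T N × shared-count T < shared-count N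

      replace-keeps-shared : ∀ {T e₁ e₂ a b} → ¬ Shared T e₂ →
                             ∀ {w} → Shared T w → Shared (replace T e₁ e₂ a b) w
      replace-keeps-shared _ root = root
      replace-keeps-shared {T} {e₁} {e₂} {a} {b} ¬se₂ (extend T′xw Txw sx) =
        extend T′xw (replace-keep T e₁ e₂ a b (λ { (_ , refl) → ¬se₂ (extend T′xw Txw sx) }) Txw)
               (replace-keeps-shared ¬se₂ sx)

      frontier : ∀ T fuel y → R′.rank y < fuel → InV T′ y → ¬ Shared T y →
                 ∃ λ a → ∃ λ b → T′ a b ≡ true × Shared T a × ¬ Shared T b
      frontier T (suc fuel) y y<fuel y∈V ¬sy with y ≟ r
      ... | yes refl = ⊥-elim (¬sy root)
      ... | no y≢r with a , T′ay ← R′.parent y y∈V y≢r with shared? T a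
      ... | yes sa  = a , y , T′ay , sa , ¬sy
      ... | no ¬sa  = frontier T fuel a (≤-trans (R′.rank-< T′ay) (≤-pred y<fuel)) (y , inj₁ T′ay) ¬sa

      module _ {T : ArcSet n} (R : RankedTree T r) where
        open RankedTree R

        shared∈V : ∀ {a} → Shared T a → InV T a
        shared∈V root               = root∈V
        shared∈V (extend _ Tab _)   = _ , inj₂ Tab

        shared-ancestor : ∀ {b w} → Descendant T b w → Shared T w → Shared T b
        shared-ancestor self          sw = sw
        shared-ancestor (child Tzw d) sw with a , _ , Taw , sa ← shared-parent sw (λ { refl → root-parentless Tzw })
                                         with refl ← parent-unique Taw Tzw = shared-ancestor d sa

        arc-into-shared-of-T′ : ∀ {x y} → T′ x y ≡ true → Shared T y → T x y ≡ true
        arc-into-shared-of-T′ T′xy sy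
          with a , T′ay , Tay , _ ← shared-parent sy (λ { refl → R′.root-parentless T′xy })
          with refl ← R′.parent-unique T′xy T′ay = Tay

        arc-into-shared-of-T : ∀ {x y} → T x y ≡ true → Shared T y → T′ x y ≡ true
        arc-into-shared-of-T Txy sy with a , T′ay , Tay , _ ← shared-parent sy (λ { refl → root-parentless Txy })
                                    with refl ← parent-unique Txy Tay = T′ay

      module _ {T : ArcSet n} (tT : RootedTreeIn r T) {a b : Fin n}
               (T′ab : T′ a b ≡ true) (sa : Shared T a) (¬sb : ¬ Shared T b) where
        private
          R = proj₂ (proj₂ tT)
          open RankedTree R
          open TreeOperations R

          Tab : T a b ≡ false
          Tab = Bool.¬-not λ Tab → ¬sb (extend T′ab Tab sa)

          b≢r : ¬ b ≡ r
          b≢r refl = R′.root-parentless T′ab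

          add-frontier-arc : ∀ {e₁ e₂} → ¬ Shared T e₂ → T e₁ e₂ ≡ true → RankedTree (replace T e₁ e₂ a b) r →
                           Closer T
          add-frontier-arc {e₁} {e₂} ¬se₂ Te₁e₂ RN
            with tN , T~N ← replace-rootedTreeIn tT Te₁e₂ Tab (proj₁ tT′ a b T′ab) RN =
            _ , tN , T~N , shared-count-< keeps ¬sb (extend T′ab (replace-new T e₁ e₂ a b) (keeps sa))
            where keeps = replace-keeps-shared ¬se₂

          add-frontier-arc-by-leaf-move : ∀ {x y} → T x y ≡ true → ¬ Shared T y → ¬ InV T b →
                                       Closer T
          add-frontier-arc-by-leaf-move Txy ¬sy b∉V =
            let a₀ , ℓ , Ta₀ℓ , leaf , y⇝ℓ = leaf-below Txy
                ¬sℓ = ¬sy ∘ shared-ancestor R y⇝ℓ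
            in add-frontier-arc ¬sℓ Ta₀ℓ (move-leaf Ta₀ℓ leaf (shared∈V R sa) (λ { refl → ¬sℓ sa }) b∉V)

          heads-shared⇒⊥ : (∀ x y → T x y ≡ true → Shared T y) → ⊥
          heads-shared⇒⊥ heads-shared = Bool.not-¬ (trans (T≐T′ a b) T′ab) Tab
            where
              T≐T′ : T ≐ T′
              T≐T′ = ⊆ₐ∧∣∣ₐ≡⇒≐ (λ x y Txy → arc-into-shared-of-T R Txy (heads-shared x y Txy))
                               (trans (proj₁ (proj₂ tT)) (sym (proj₁ (proj₂ tT′))))

        -- Make the frontier arc (a , b) of T′ an arc of T: if b is a vertex of T, rehang it below a.
        -- Otherwise some arc of T has an unshared head (else T ⊆ T′, and equal sizes would give
        -- (a , b) ∈ T), and a leaf below that head is moved to b.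
        extend-shared : Closer T
        extend-shared with InV? T b
        ... | yes b∈V with c , Tcb ← parent b b∈V b≢r =
          add-frontier-arc ¬sb Tcb (rehang Tcb b≢r (shared∈V R sa) λ b⇝a → ¬sb (shared-ancestor R b⇝a sa))
        ... | no b∉V with any? (λ x → any? (λ y → (T x y Bool.≟ true) ×-dec ¬? (shared? T y)))
        ...   | yes (x , y , Txy , ¬sy) = add-frontier-arc-by-leaf-move Txy ¬sy b∉V
        ...   | no none = ⊥-elim (heads-shared⇒⊥ λ x y Txy →
                                   decidable-stable (shared? T y) λ ¬sy → none (x , y , Txy , ¬sy))

      chain-to-T′ : ∀ {T} → RootedTreeIn r T → Chain T T′
      chain-to-T′ {T} tT = converge (suc n) tT (m≤n+m (suc n) (shared-count T))
        where
          converge : ∀ fuel {T} → RootedTreeIn r T → n < shared-count T + fuel → Chain T T′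
          converge zero {T} _ bound =
            ⊥-elim (<-irrefl refl (<-≤-trans (subst (n <_) (+-identityʳ _) bound) (count≤ _)))
          converge (suc fuel) {T} tT@(_ , ∣T∣ , R) bound with any? (λ y → InV? T′ y ×-dec ¬? (shared? T y))
          ... | yes (y , y∈V′ , ¬sy) =
            let a , b , T′ab , sa , ¬sb = frontier T _ y ≤-refl y∈V′ ¬sy
                N , tN , T~N , more    = extend-shared tT T′ab sa ¬sb
            in step (RootedTreeIn⇒DirTreeIn tT) T~N
                    (converge fuel tN (<-≤-trans (subst (n <_) (+-suc _ fuel) bound) (+-monoˡ-≤ fuel more)))
          ... | no none = done (RootedTreeIn⇒DirTreeIn tT) (RootedTreeIn⇒DirTreeIn tT′)
                               (≐-sym (⊆ₐ∧∣∣ₐ≡⇒≐ T′⊆T (trans (proj₁ (proj₂ tT′)) (sym ∣T∣))))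
            where
              T′⊆T : T′ ⊆ₐ T
              T′⊆T x y T′xy = arc-into-shared-of-T′ R T′xy
                                (decidable-stable (shared? T y) λ ¬sy → none (y , (x , inj₂ T′xy) , ¬sy))

corollary2 : (n : ℕ) (G : Digraph n) (k : ℕ) → 1 ≤ k →
    (u v : Fin n) → ¬ (u ≡ v) →
    (T T′ : ArcSet n) →
    T ⊆ₐ G → ∣ T ∣ₐ ≡ k → IsDirTree T u →
    T′ ⊆ₐ G → ∣ T′ ∣ₐ ≡ k → IsDirTree T′ v →
    DPath G u v ⊎ DPath G v u →
    Σ ℕ λ ℓ → Σ (Fin (suc ℓ) → ArcSet n) λ Ts →
      Ts zero ≡ T × Ts (fromℕ ℓ) ≡ T′ ×
      (∀ i → DirTreeIn G k (Ts i)) ×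
      (∀ (i : Fin ℓ) → ∣ Ts (inject₁ i) ∖ Ts (suc i) ∣ₐ ≡ 1
                     × ∣ Ts (suc i) ∖ Ts (inject₁ i) ∣ₐ ≡ 1)
corollary2 n G k 1≤k u v u≢v T T′ T⊆G ∣T∣ dT T′⊆G ∣T′∣ dT′ path =
  chain⇒sequence (chain path) (distinct-roots⇒≉ R R′ u≢v)
  where
    open TreesIn G k
    R  = DirTreeRanking.rankedTree dT
    R′ = DirTreeRanking.rankedTree dT′

    chain : DPath G u v ⊎ DPath G v u → Chain T T′
    chain (inj₁ (w , w-path)) =
      let W , tW , W⇝T′ = reroot-along-path 1≤k w w-path (T′⊆G , ∣T′∣ , R′)
      in SameRoot.chain-to-T′ tW (T⊆G , ∣T∣ , R) ++ᶜ W⇝T′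
    chain (inj₂ (w , w-path)) =
      let W , tW , W⇝T = reroot-along-path 1≤k w w-path (T⊆G , ∣T∣ , R)
      in chain-reverse (SameRoot.chain-to-T′ tW (T′⊆G , ∣T′∣ , R′) ++ᶜ W⇝T)
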